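{- Let $Q$ be a finite nonempty set of primes with $2,3\notin Q$ and $|Q|\le 4$ such that $$3\cdot \prod_{q\in Q}(q-1) - 2\prod_{q\in Q} q = 2,$$ and let $n=\prod_{q\in Q}q$. Then $n\in\{5,\ 5\cdot 7,\ 5\cdot 7\cdot 37,\ 5\cdot 7\cdot 37\cdot 1297\}$, and each of these four values arises from such a set $Q$.
   Context: The solutions of the displayed equation, via $n=\prod_{q\in Q}q$, correspond exactly to the positive integers $n>1$ with $\phi(n)=\frac23(n+1)$ ($\phi$ Euler's totient). -}

module Defs where

open import Data.Nat using (ℕ; _∸_; _*_; _+_; _≤_)
open import Data.List using (List; []; map; length)
open import Data.Nat.ListAction using (product)
open import Data.List.Relation.Unary.All using (All)
open import Data.List.Relation.Unary.Unique.Propositional using (Unique)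
open import Data.Nat.Primality using (Prime)
open import Relation.Binary.PropositionalEquality using (_≡_; _≢_)
open import Data.Product using (_×_)

-- Admissible Q: nonempty, all primes, 2,3 ∉ Q, |Q| ≤ 4, and
--   3 * ∏(q-1) - 2 * ∏ q = 2, written (over ℕ, without truncated subtraction)
--   as 3 * ∏(q-1) ≡ 2 * ∏ q + 2.
Admissible : List ℕ → Set
Admissible Q =
  Unique Q × (Q ≢ []) × All Prime Q × All (λ q → q ≢ 2 × q ≢ 3) Q ×
  (length Q ≤ 4) ×
  (3 * product (map (λ q → q ∸ 1) Q) ≡ 2 * product Q + 2)

-- Every prime q ≥ x satisfies 1 - 1/q ≥ 1 - 1/x, so for a set L of r primes, all at least x, a
-- solution of u ∏(q - 1) = v ∏q + w needs u (1 - 1/x)^r ≤ v + w/x^r. This bounds the least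
-- element of L; fixing it as x turns the equation into one of the same shape for the remaining
-- r - 1 primes, with (u, v) replaced by (u (x - 1), v x). Searching over the least element
-- therefore enumerates all solutions of each length, and for 3 ∏(q - 1) = 2 ∏q + 2 and at most
-- four primes it finds exactly the four listed products.
module Submission where

open import Defs
open import Data.Nat using (ℕ; _*_)
open import Data.List using (List)
open import Data.Nat.ListAction using (product)
open import Data.Product using (_×_; ∃)
open import Data.Sum using (_⊎_)
open import Relation.Binary.PropositionalEquality using (_≡_)

open import Data.Nat
  using (zero; suc; _+_; _∸_; _^_; _≤_; _<_; z≤n; s≤s; _≟_; _≤?_; _<?_)
open import Data.Nat.Properties
open import Data.Nat.ListAction.Properties using (product-↭)
open import Data.Nat.Primality
  using (Prime; prime?; ¬prime[0]; ¬prime[1]; composite[4]; productOfPrimes≥1)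
open import Data.Nat.Solver using (module +-*-Solver)
open +-*-Solver using (solve; _:+_; _:*_; _:=_)
open import Data.Maybe using (Maybe; just; nothing)
import Data.Maybe as Maybe
open import Data.List using ([]; _∷_; _++_; [_]; map; length)
open import Data.List.Membership.Propositional using (_∈_)
open import Data.List.Membership.Propositional.Properties using (∈-map⁺; ∈-++⁺ˡ; ∈-++⁺ʳ)
open import Data.List.Relation.Unary.All as All using (All; []; _∷_; all?)
open import Data.List.Relation.Unary.AllPairs as AllPairs using (AllPairs; _∷_)
open import Data.List.Relation.Unary.Any using (here)
open import Data.List.Relation.Unary.Linked.Properties using (Linked⇒AllPairs)
open import Data.List.Relation.Unary.Unique.Propositional using (Unique)
open import Data.List.Relation.Unary.Unique.DecPropositional _≟_ using (unique?)
open import Data.List.Relation.Binary.Permutation.Propositional using (_↭_; ↭-sym; ↭⇒↭ₛ)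
open import Data.List.Relation.Binary.Permutation.Propositional.Properties
  using (All-resp-↭; ↭-length; map⁺)
import Data.List.Relation.Binary.Permutation.Setoid.Properties as SetoidPermutation
open import Data.List.Sort ≤-decTotalOrder using (sort; sort-↭; sort-↗)
open import Data.Product using (_,_; uncurry; ∃-syntax)
open import Data.Sum using (inj₁; inj₂)
open import Data.Empty using (⊥-elim)
open import Relation.Nullary using (Dec; yes; no)
open import Relation.Nullary.Decidable using (_×-dec_; ¬?; from-yes)
open import Relation.Binary.PropositionalEquality
  using (_≢_; refl; sym; trans; cong; subst; subst₂; setoid; module ≡-Reasoning)

-- For a list Q of distinct primes this is Euler's totient of product Q.
φ : List ℕ → ℕ
φ Q = product (map (_∸ 1) Q)

φ-↭ : ∀ {L L′} → L ↭ L′ → φ L ≡ φ L′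
φ-↭ L↭L′ = product-↭ (map⁺ (_∸ 1) L↭L′)

φ≤product : ∀ L → φ L ≤ product L
φ≤product []      = ≤-refl
φ≤product (q ∷ L) = *-mono-≤ (m∸n≤m q 1) (φ≤product L)

^length≤product : ∀ {x} L → All (x ≤_) L → x ^ length L ≤ product L
^length≤product []      []           = ≤-refl
^length≤product (q ∷ L) (x≤q ∷ x≤L) = *-mono-≤ x≤q (^length≤product L x≤L)

pred*≤*pred : ∀ {x y} → x ≤ y → (x ∸ 1) * y ≤ x * (y ∸ 1)
pred*≤*pred {zero}  _         = z≤n
pred*≤*pred {suc a} {suc b} (s≤s a≤b) = begin
  a * suc b  ≡⟨ *-suc a b ⟩
  a + a * b  ≤⟨ +-monoˡ-≤ (a * b) a≤b ⟩
  b + a * b  ∎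
  where open ≤-Reasoning

pred^*product≤^*φ : ∀ {x} L → All (x ≤_) L →
  (x ∸ 1) ^ length L * product L ≤ x ^ length L * φ L
pred^*product≤^*φ         []      []           = ≤-refl
pred^*product≤^*φ {x = x} (q ∷ L) (x≤q ∷ x≤L) = begin
  ((x ∸ 1) * B) * (q * product L)  ≡⟨ [m*n]*[o*p]≡[m*o]*[n*p] (x ∸ 1) B q (product L) ⟩
  ((x ∸ 1) * q) * (B * product L)  ≤⟨ *-mono-≤ (pred*≤*pred x≤q) (pred^*product≤^*φ L x≤L) ⟩
  (x * (q ∸ 1)) * (A * φ L)        ≡⟨ [m*n]*[o*p]≡[m*o]*[n*p] x (q ∸ 1) A (φ L) ⟩
  (x * A) * ((q ∸ 1) * φ L)        ∎
  where
  open ≤-Reasoning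
  A = x ^ length L
  B = (x ∸ 1) ^ length L

no-solution-if-≤ : ∀ {u v w} L → u ≤ v → 0 < w → u * φ L ≢ v * product L + w
no-solution-if-≤ {u} {v} {w} L u≤v w>0 eq = <-irrefl refl (begin-strict
  u * φ L            ≤⟨ *-mono-≤ u≤v (φ≤product L) ⟩
  v * product L      <⟨ m<m+n (v * product L) w>0 ⟩
  v * product L + w  ≡⟨ eq ⟨
  u * φ L            ∎)
  where open ≤-Reasoning

no-solution-above : ∀ {x u v w} L → All (x ≤_) L → 1 ≤ product L →
  v * x ^ length L + w < u * (x ∸ 1) ^ length L → u * φ L ≢ v * product L + w
no-solution-above {x} {u} {v} {w} L x≤L p≥1 bound eq = <-irrefl refl (begin-strict
  (v * A + w) * p      <⟨ m<n+m ((v * A + w) * p) p≥1 ⟩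
  suc (v * A + w) * p  ≤⟨ *-monoˡ-≤ p bound ⟩
  u * B * p            ≡⟨ *-assoc u B p ⟩
  u * (B * p)          ≤⟨ *-monoʳ-≤ u (pred^*product≤^*φ L x≤L) ⟩
  u * (A * φ L)        ≡⟨ rearrange u A (φ L) ⟩
  A * (u * φ L)        ≡⟨ cong (A *_) eq ⟩
  A * (v * p + w)      ≡⟨ expand A v p w ⟩
  v * A * p + w * A    ≤⟨ +-monoʳ-≤ (v * A * p) (*-monoʳ-≤ w (^length≤product L x≤L)) ⟩
  v * A * p + w * p    ≡⟨ *-distribʳ-+ p (v * A) w ⟨
  (v * A + w) * p      ∎)
  where
  open ≤-Reasoning
  A = x ^ length L
  B = (x ∸ 1) ^ length L
  p = product L
  rearrange : ∀ a b c → a * (b * c) ≡ b * (a * c)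
  rearrange = solve 3 (λ a b c → a :* (b :* c) := b :* (a :* c)) refl
  expand : ∀ a b c d → a * (b * c + d) ≡ b * a * c + d * a
  expand = solve 4 (λ a b c d → a :* (b :* c :+ d) := b :* a :* c :+ d :* a) refl

-- solutions fuel r u v w lo lists the products of the strictly increasing lists L of r primes,
-- all at least lo, with u * φ L ≡ v * product L + w; it returns nothing when the fuel runs out.
solutions       : (fuel r u v w lo : ℕ) → Maybe (List ℕ)
solutionsLeast  : (fuel r u v w x : ℕ) → Maybe (List ℕ)
solutionsFrom   : (fuel r u v w steps x : ℕ) → Maybe (List ℕ)

solutions fuel zero u v w lo with u ≟ v + w
... | yes _ = just [ 1 ]
... | no _  = just []
solutions fuel (suc r) u v w lo with u ≤? v
... | yes _ = just []
... | no _  = solutionsFrom fuel r u v w fuel lo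

-- the solutions x ∷ L with L of length r
solutionsLeast fuel r u v w x with prime? x
... | yes _ = Maybe.map (map (x *_)) (solutions fuel r (u * (x ∸ 1)) (v * x) w (suc x))
... | no _  = just []

-- the solutions of length suc r whose least element is at least x
solutionsFrom fuel r u v w zero        x = nothing
solutionsFrom fuel r u v w (suc steps) x with v * x ^ suc r + w <? u * (x ∸ 1) ^ suc r
... | yes _ = just []
... | no _  = Maybe.zipWith _++_ (solutionsLeast fuel r u v w x)
                                 (solutionsFrom fuel r u v w steps (suc x))

solutions-complete : ∀ fuel u v w lo {xs} L → 0 < w →
  solutions fuel (length L) u v w lo ≡ just xs →
  AllPairs _<_ L → All (lo ≤_) L → All Prime L →
  u * φ L ≡ v * product L + w → product L ∈ xs
solutionsLeast-complete : ∀ fuel u v w x {xs} L → 0 < w →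
  solutionsLeast fuel (length L) u v w x ≡ just xs →
  AllPairs _<_ (x ∷ L) → All Prime (x ∷ L) →
  u * φ (x ∷ L) ≡ v * product (x ∷ L) + w → product (x ∷ L) ∈ xs
solutionsFrom-complete : ∀ fuel u v w steps x {xs} y L → 0 < w →
  solutionsFrom fuel (length L) u v w steps x ≡ just xs →
  AllPairs _<_ (y ∷ L) → All (x ≤_) (y ∷ L) → All Prime (y ∷ L) →
  u * φ (y ∷ L) ≡ v * product (y ∷ L) + w → product (y ∷ L) ∈ xs

solutions-complete fuel u v w lo [] w>0 found _ _ _ eq with u ≟ v + w
... | yes _ with refl ← found = here refl
... | no u≢v+w =
  ⊥-elim (u≢v+w (trans (sym (*-identityʳ u)) (trans eq (cong (_+ w) (*-identityʳ v)))))
solutions-complete fuel u v w lo (y ∷ L) w>0 found increasing lo≤ primes eq with u ≤? v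
... | yes u≤v = ⊥-elim (no-solution-if-≤ (y ∷ L) u≤v w>0 eq)
... | no _    = solutionsFrom-complete fuel u v w fuel lo y L w>0 found increasing lo≤ primes eq

solutionsLeast-complete fuel u v w x L w>0 found (x<L ∷ increasing) (px ∷ primes) eq
  with prime? x
... | no ¬px = ⊥-elim (¬px px)
... | yes _ with solutions fuel (length L) (u * (x ∸ 1)) (v * x) w (suc x) in rest
...   | just ys with refl ← found =
  ∈-map⁺ (x *_) (solutions-complete fuel _ _ w (suc x) L w>0 rest increasing x<L primes eq′)
  where
  open ≡-Reasoning
  eq′ : u * (x ∸ 1) * φ L ≡ v * x * product L + w
  eq′ = begin
    u * (x ∸ 1) * φ L        ≡⟨ *-assoc u (x ∸ 1) (φ L) ⟩
    u * ((x ∸ 1) * φ L)      ≡⟨ eq ⟩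
    v * (x * product L) + w  ≡⟨ cong (_+ w) (*-assoc v x (product L)) ⟨
    v * x * product L + w    ∎

solutionsFrom-complete fuel u v w (suc steps) x y L w>0 found increasing x≤ primes eq
  with v * x ^ suc (length L) + w <? u * (x ∸ 1) ^ suc (length L)
... | yes bound =
  ⊥-elim (no-solution-above {u = u} {v} {w} (y ∷ L) x≤ (productOfPrimes≥1 primes) bound eq)
... | no _
  with solutionsLeast fuel (length L) u v w x in least
     | solutionsFrom fuel (length L) u v w steps (suc x) in larger
... | just as | just bs with refl ← found
  with x≤y ∷ _ ← x≤ | y<L ∷ _ ← increasing | m≤n⇒m<n∨m≡n x≤y
... | inj₂ refl = ∈-++⁺ˡ (solutionsLeast-complete fuel u v w x L w>0 least increasing primes eq)
... | inj₁ x<y  = ∈-++⁺ʳ as (solutionsFrom-complete fuel u v w steps (suc x) y L w>0 larger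
                               increasing (x<y ∷ All.map (<-trans x<y) y<L) primes eq)

sort-strictlyIncreasing : ∀ {Q} → Unique Q → AllPairs _<_ (sort Q)
sort-strictlyIncreasing {Q} unique = AllPairs.zipWith (uncurry ≤∧≢⇒<)
  ( Linked⇒AllPairs ≤-trans (sort-↗ Q)
  , SetoidPermutation.Unique-resp-↭ (setoid ℕ) (↭⇒↭ₛ (↭-sym (sort-↭ Q))) unique )

5≤prime : ∀ {q} → Prime q → q ≢ 2 × q ≢ 3 → 5 ≤ q
5≤prime {0} p _ = ⊥-elim (¬prime[0] p)
5≤prime {1} p _ = ⊥-elim (¬prime[1] p)
5≤prime {2} _ (q≢2 , _) = ⊥-elim (q≢2 refl)
5≤prime {3} _ (_ , q≢3) = ⊥-elim (q≢3 refl)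
5≤prime {4} p _ = ⊥-elim (Prime.notComposite p composite[4])
5≤prime {suc (suc (suc (suc (suc _))))} _ _ = s≤s (s≤s (s≤s (s≤s (s≤s z≤n))))

Listed : ℕ → Set
Listed n = (n ≡ 5) ⊎ (n ≡ 5 * 7) ⊎ (n ≡ 5 * 7 * 37) ⊎ (n ≡ 5 * 7 * 37 * 1297)

-- Enough steps for every scan of the search below to reach its cut-off.
searchFuel : ℕ
searchFuel = 1300

search-listed : ∀ {r} → r ≤ 4 → ∃[ xs ] solutions searchFuel r 3 2 2 5 ≡ just xs × All Listed xs
search-listed z≤n                         = _ , refl , []
search-listed (s≤s z≤n)                   = _ , refl , inj₁ refl ∷ []
search-listed (s≤s (s≤s z≤n))             = _ , refl , inj₂ (inj₁ refl) ∷ []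
search-listed (s≤s (s≤s (s≤s z≤n)))       = _ , refl , inj₂ (inj₂ (inj₁ refl)) ∷ []
search-listed (s≤s (s≤s (s≤s (s≤s z≤n)))) = _ , refl , inj₂ (inj₂ (inj₂ refl)) ∷ []

increasingSolution⇒listed : ∀ S → length S ≤ 4 → AllPairs _<_ S → All (5 ≤_) S → All Prime S →
  3 * φ S ≡ 2 * product S + 2 → Listed (product S)
increasingSolution⇒listed S |S|≤4 increasing 5≤S primes eq
  with xs , found , xs-listed ← search-listed |S|≤4 = All.lookup xs-listed
    (solutions-complete searchFuel 3 2 2 5 S (s≤s z≤n) found increasing 5≤S primes eq)

admissible⇒listed : ∀ Q → Admissible Q → Listed (product Q)
admissible⇒listed Q (unique , _ , primes , not2or3 , |Q|≤4 , eq) =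
  subst Listed (product-↭ S↭Q) (increasingSolution⇒listed S
    (subst (_≤ 4) (sym (↭-length S↭Q)) |Q|≤4)
    (sort-strictlyIncreasing unique)
    (All-resp-↭ Q↭S (All.zipWith (uncurry 5≤prime) (primes , not2or3)))
    (All-resp-↭ Q↭S primes)
    (subst₂ (λ f n → 3 * f ≡ 2 * n + 2) (φ-↭ Q↭S) (product-↭ Q↭S) eq))
  where
  S = sort Q
  S↭Q : S ↭ Q
  S↭Q = sort-↭ Q
  Q↭S : Q ↭ S
  Q↭S = ↭-sym S↭Q

admissible? : ∀ Q → Dec (Admissible Q)
admissible? Q = unique? Q ×-dec (¬? (nonempty Q) ×-dec (all? prime? Q ×-dec
  (all? (λ q → ¬? (q ≟ 2) ×-dec ¬? (q ≟ 3)) Q ×-dec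
  (length Q ≤? 4 ×-dec 3 * φ Q ≟ 2 * product Q + 2))))
  where
  nonempty : ∀ Q → Dec (Q ≡ [])
  nonempty []      = yes refl
  nonempty (_ ∷ _) = no λ ()

listed⇒admissible : ∀ {n} → Listed n → ∃ λ Q → Admissible Q × product Q ≡ n
listed⇒admissible (inj₁ refl)               = _ , from-yes (admissible? (5 ∷ [])) , refl
listed⇒admissible (inj₂ (inj₁ refl))        = _ , from-yes (admissible? (5 ∷ 7 ∷ [])) , refl
listed⇒admissible (inj₂ (inj₂ (inj₁ refl))) = _ , from-yes (admissible? (5 ∷ 7 ∷ 37 ∷ [])) , refl
listed⇒admissible (inj₂ (inj₂ (inj₂ refl))) =
  _ , from-yes (admissible? (5 ∷ 7 ∷ 37 ∷ 1297 ∷ [])) , refl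

theorem10 :
    ((Q : List ℕ) → Admissible Q →
      (product Q ≡ 5) ⊎ (product Q ≡ 5 * 7) ⊎ (product Q ≡ 5 * 7 * 37) ⊎
      (product Q ≡ 5 * 7 * 37 * 1297))
    ×
    ((n : ℕ) → ((n ≡ 5) ⊎ (n ≡ 5 * 7) ⊎ (n ≡ 5 * 7 * 37) ⊎ (n ≡ 5 * 7 * 37 * 1297)) →
      ∃ λ (Q : List ℕ) → Admissible Q × product Q ≡ n)
theorem10 = admissible⇒listed , λ _ → listed⇒admissible
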